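{- Let $n_1,\dots,n_r,k$ be integers with $\min\{n_1,\dots,n_r\}>2k>0$. View $S_{n_1}\times\dots\times S_{n_r}$ as acting on disjoint sets $E_1,\dots,E_r$ with $|E_i|=n_i$, and in each $E_i$ fix a subset $F_i$ of size $k$; let $S_{n_1-k}\times\dots\times S_{n_r-k}$ denote the subgroup of elements fixing every point of $F_1\cup\dots\cup F_r$. Let $g\in S_{n_1}\times\dots\times S_{n_r}$ be such that for every $i$, all cycles of the projection of $g$ to $S_{n_i}$ have length greater than $k$. Then $S_{n_1-k}\times\dots\times S_{n_r-k}$ and $\langle g\rangle$ invariably generate $S_{n_1}\times\dots\times S_{n_r}$.
   Context: Subgroups $\{H_i\}_{i\in I}$ of a group $H$ invariably generate $H$ if for every choice of $\sigma_i\in H$, the conjugates $\{\sigma_i^{ -1}H_i\sigma_i\}$ generate $H$. -}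

module Defs where

open import Data.Nat using (ℕ; zero; suc; _≤_; _<_)
open import Data.Fin using (Fin)
open import Data.Fin.Permutation using (Permutation′; _⟨$⟩ʳ_; id; flip; _∘ₚ_)
open import Data.Fin.Subset using (Subset; _∈_)
open import Data.Product using (Σ; _×_; ∃)
open import Data.Sum using (_⊎_)
open import Relation.Binary.PropositionalEquality using (_≡_; _≢_)

-- The direct product S_{n_1} × … × S_{n_r}, acting on the disjoint sets
-- E_i = Fin (n i) (i : Fin r).
Prod : {r : ℕ} → (Fin r → ℕ) → Set
Prod n = ∀ i → Permutation′ (n i)

module _ {r : ℕ} {n : Fin r → ℕ} where

  _≈_ : Prod n → Prod n → Set
  g ≈ h = ∀ i x → g i ⟨$⟩ʳ x ≡ h i ⟨$⟩ʳ x

  e : Prod n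
  e i = id

  _·_ : Prod n → Prod n → Prod n
  (g · h) i = g i ∘ₚ h i

  inv : Prod n → Prod n
  inv g i = flip (g i)

  conj : Prod n → Prod n → Prod n
  conj σ h = (inv σ · h) · σ

  data Gen (S : Prod n → Set) : Prod n → Set where
    gen  : ∀ {x} → S x → Gen S x
    one  : Gen S e
    mul  : ∀ {x y} → Gen S x → Gen S y → Gen S (x · y)
    invG : ∀ {x} → Gen S x → Gen S (inv x)
    resp : ∀ {x y} → x ≈ y → Gen S x → Gen S y

  GeneratesAll : (Prod n → Set) → Set
  GeneratesAll S = ∀ x → Gen S x

  Conjugate : Prod n → (Prod n → Set) → Prod n → Set
  Conjugate σ H x = Σ (Prod n) λ h → H h × (x ≈ conj σ h)

  InvariablyGenerate : (Prod n → Set) → (Prod n → Set) → Set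
  InvariablyGenerate H₁ H₂ =
    ∀ σ₁ σ₂ → GeneratesAll (λ x → Conjugate σ₁ H₁ x ⊎ Conjugate σ₂ H₂ x)

  Cyclic : Prod n → Prod n → Set
  Cyclic g = Gen (λ x → x ≈ g)

  FixF : ((i : Fin r) → Subset (n i)) → Prod n → Set
  FixF F h = ∀ i x → x ∈ F i → h i ⟨$⟩ʳ x ≡ x

_^ₚ_ : {m : ℕ} → Permutation′ m → ℕ → Permutation′ m
π ^ₚ zero = id
π ^ₚ suc j = π ∘ₚ (π ^ₚ j)

-- All cycles of π have length > k : no point returns to itself after
-- m steps for 0 < m ≤ k (the length of the cycle through x is the least
-- m > 0 with π^m x = x).
AllCyclesLongerThan : {m : ℕ} → ℕ → Permutation′ m → Set
AllCyclesLongerThan {m} k π = ∀ (x : Fin m) (j : ℕ) → 0 < j → j ≤ k → (π ^ₚ j) ⟨$⟩ʳ x ≢ x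

{-# OPTIONS --safe #-}

-- Let G be generated by the two conjugates, let γ = σ₂⁻¹ g σ₂ and let T_i = σ₁(F_i), a set of k
-- points of E_i. The conjugated stabiliser lies in G, so G contains every transposition of two
-- points of E_i outside T_i. For any point c, the points c, γc, …, γᵏc are distinct because all
-- cycles of γ are longer than k, so some γʲc lies outside T_i; as n_i > 2k there is a point p
-- with p and γʲp both outside T_i, and conjugating the transposition (γʲc γʲp) by γ⁻ʲ puts (c p)
-- into G. Hence any two points of E_i are joined by transpositions in G, so G contains every
-- transposition of every factor, hence every factor S_{n_i}, hence the whole product.

module Submission where

open import Defs
open import Data.Empty using (⊥-elim)
open import Data.Fin using (Fin; toℕ; fromℕ<)
open import Data.Fin.Permutation
  using (Permutation′; _⟨$⟩ʳ_; _⟨$⟩ˡ_; id; flip; _∘ₚ_; transpose; inverseˡ; inverseʳ)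
  renaming (_≈_ to _≈ₚ_)
open import Data.Fin.Properties using (_≟_; any?; <-cmp; toℕ-injective; toℕ<n; toℕ≤pred[n]; toℕ-fromℕ<)
open import Data.Fin.Subset using (Subset; ∣_∣; _∈_; _∉_; _-_) renaming (⊥ to ∅)
open import Data.Fin.Subset.Properties using (_∈?_; ∣⊥∣≡0; x∈p∧x≢y⇒x∈p-y; x∈p⇒∣p-x∣<∣p∣)
open import Data.List using (List; []; _∷_; length; allFin)
open import Data.List.Properties using (length-tabulate)
open import Data.List.Relation.Unary.All as All using (All; []; _∷_)
open import Data.List.Relation.Unary.All.Properties using (tabulate⁺)
open import Data.List.Relation.Unary.AllPairs using (_∷_)
open import Data.List.Relation.Unary.Unique.Propositional using (Unique)
open import Data.List.Relation.Unary.Unique.Propositional.Properties using (allFin⁺)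
open import Data.Nat using (ℕ; zero; suc; _+_; _*_; _∸_; _≤_; _<_; z≤n; s≤s)
open import Data.Nat.Properties
  using (≤-trans; ≤-<-trans; <⇒≤; <⇒≱; ≤∧≢⇒<; m∸n≤m; m<n⇒0<n∸m; m+[n∸m]≡n; +-suc; +-identityʳ;
         +-monoˡ-≤; +-monoʳ-≤; n<1+n; module ≤-Reasoning)
  renaming (_<?_ to _<ℕ?_)
open import Data.Product using (_×_; _,_; ∃; proj₁; map)
open import Data.Sum using (_⊎_; inj₁; inj₂; map₁; map₂)
open import Function.Definitions using (Injective)
open import Relation.Binary.Definitions using (tri<; tri≈; tri>)
open import Relation.Binary.PropositionalEquality
  using (_≡_; _≢_; refl; sym; trans; cong; cong₂; subst; subst₂; module ≡-Reasoning)
open import Relation.Nullary using (Dec; yes; no; ¬_)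
open import Relation.Nullary.Decidable using (¬?; _×-dec_)

module _ {m : ℕ} where

  transposeˡ : (a b : Fin m) → transpose a b ⟨$⟩ʳ a ≡ b
  transposeˡ a b with a ≟ a
  ... | yes _   = refl
  ... | no  a≢a = ⊥-elim (a≢a refl)

  transposeʳ : (a b : Fin m) → transpose a b ⟨$⟩ʳ b ≡ a
  transposeʳ a b with b ≟ a
  ... | yes b≡a = b≡a
  ... | no  _ with b ≟ b
  ...   | yes _   = refl
  ...   | no  b≢b = ⊥-elim (b≢b refl)

  transpose-≢ : {a b c : Fin m} → c ≢ a → c ≢ b → transpose a b ⟨$⟩ʳ c ≡ c
  transpose-≢ {a} {b} {c} c≢a c≢b with c ≟ a
  ... | yes c≡a = ⊥-elim (c≢a c≡a)
  ... | no  _ with c ≟ b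
  ...   | yes c≡b = ⊥-elim (c≢b c≡b)
  ...   | no  _   = refl

  -- Case splits go through an explicit Dec argument: a `with c ≟ a` would also abstract the
  -- identical test inside the unfolded transpose in the goal and break the lemmas above.
  transpose-comm : (a b : Fin m) → transpose a b ≈ₚ transpose b a
  transpose-comm a b c = by-cases (c ≟ a) (c ≟ b)
    where
      by-cases : Dec (c ≡ a) → Dec (c ≡ b) → transpose a b ⟨$⟩ʳ c ≡ transpose b a ⟨$⟩ʳ c
      by-cases (yes refl) _          = trans (transposeˡ c b) (sym (transposeʳ b c))
      by-cases (no _)     (yes refl) = trans (transposeʳ a c) (sym (transposeˡ c a))
      by-cases (no c≢a)   (no c≢b)   = trans (transpose-≢ c≢a c≢b) (sym (transpose-≢ c≢b c≢a))

  transpose-self : (a : Fin m) → transpose a a ≈ₚ id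
  transpose-self a c = by-cases (c ≟ a)
    where
      by-cases : Dec (c ≡ a) → transpose a a ⟨$⟩ʳ c ≡ c
      by-cases (yes refl) = transposeˡ c c
      by-cases (no c≢a)   = transpose-≢ c≢a c≢a

  transpose-involutive : (a b : Fin m) → transpose a b ∘ₚ transpose a b ≈ₚ id
  transpose-involutive a b c =
    trans (cong (transpose a b ⟨$⟩ʳ_) (transpose-comm a b c)) (inverseʳ (transpose a b))

  transpose-conj : (π : Permutation′ m) (a b : Fin m) →
                   (flip π ∘ₚ transpose a b) ∘ₚ π ≈ₚ transpose (π ⟨$⟩ʳ a) (π ⟨$⟩ʳ b)
  transpose-conj π a b x = by-cases x (x ≟ π ⟨$⟩ʳ a) (x ≟ π ⟨$⟩ʳ b)
    where
      open ≡-Reasoning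
      τ = transpose a b
      τ′ = transpose (π ⟨$⟩ʳ a) (π ⟨$⟩ʳ b)
      ≢-image : ∀ {y z} → z ≢ π ⟨$⟩ʳ y → π ⟨$⟩ˡ z ≢ y
      ≢-image z≢πy eq = z≢πy (trans (sym (inverseʳ π)) (cong (π ⟨$⟩ʳ_) eq))
      by-cases : ∀ z → Dec (z ≡ π ⟨$⟩ʳ a) → Dec (z ≡ π ⟨$⟩ʳ b) → π ⟨$⟩ʳ (τ ⟨$⟩ʳ (π ⟨$⟩ˡ z)) ≡ τ′ ⟨$⟩ʳ z
      by-cases _ (yes refl) _ = begin
        π ⟨$⟩ʳ (τ ⟨$⟩ʳ (π ⟨$⟩ˡ (π ⟨$⟩ʳ a))) ≡⟨ cong (λ y → π ⟨$⟩ʳ (τ ⟨$⟩ʳ y)) (inverseˡ π) ⟩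
        π ⟨$⟩ʳ (τ ⟨$⟩ʳ a)                   ≡⟨ cong (π ⟨$⟩ʳ_) (transposeˡ a b) ⟩
        π ⟨$⟩ʳ b                            ≡⟨ sym (transposeˡ (π ⟨$⟩ʳ a) (π ⟨$⟩ʳ b)) ⟩
        τ′ ⟨$⟩ʳ (π ⟨$⟩ʳ a)                  ∎
      by-cases _ (no _) (yes refl) = begin
        π ⟨$⟩ʳ (τ ⟨$⟩ʳ (π ⟨$⟩ˡ (π ⟨$⟩ʳ b))) ≡⟨ cong (λ y → π ⟨$⟩ʳ (τ ⟨$⟩ʳ y)) (inverseˡ π) ⟩
        π ⟨$⟩ʳ (τ ⟨$⟩ʳ b)                   ≡⟨ cong (π ⟨$⟩ʳ_) (transposeʳ a b) ⟩
        π ⟨$⟩ʳ a                            ≡⟨ sym (transposeʳ (π ⟨$⟩ʳ a) (π ⟨$⟩ʳ b)) ⟩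
        τ′ ⟨$⟩ʳ (π ⟨$⟩ʳ b)                  ∎
      by-cases z (no z≢πa) (no z≢πb) = begin
        π ⟨$⟩ʳ (τ ⟨$⟩ʳ (π ⟨$⟩ˡ z)) ≡⟨ cong (π ⟨$⟩ʳ_) (transpose-≢ (≢-image z≢πa) (≢-image z≢πb)) ⟩
        π ⟨$⟩ʳ (π ⟨$⟩ˡ z)          ≡⟨ inverseʳ π ⟩
        z                          ≡⟨ sym (transpose-≢ z≢πa z≢πb) ⟩
        τ′ ⟨$⟩ʳ z                  ∎

module _ {m : ℕ} (P : Permutation′ m → Set)
         (P-resp : ∀ {π ρ} → π ≈ₚ ρ → P π → P ρ) (P-id : P id)
         (P-∘ₚ : ∀ {π ρ} → P π → P ρ → P (π ∘ₚ ρ)) (P-transpose : ∀ a b → P (transpose a b)) where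

  private
    fixing-from : ∀ j π → (∀ a → j ≤ toℕ a → π ⟨$⟩ʳ a ≡ a) → P π
    fixing-from zero π fixed = P-resp (λ a → sym (fixed a z≤n)) P-id
    fixing-from (suc j) π fixed with j <ℕ? m
    ... | no  j≮m = fixing-from j π (λ a j≤a → ⊥-elim (j≮m (≤-<-trans j≤a (toℕ<n a))))
    ... | yes j<m = P-resp (λ c → cong (π ⟨$⟩ʳ_) (transpose-involutive a b c))
                           (P-∘ₚ (P-transpose a b) (fixing-from j w w-fixed))
      where
        a = fromℕ< j<m
        b = π ⟨$⟩ˡ a
        w = transpose a b ∘ₚ π
        w-fixed : ∀ c → j ≤ toℕ c → w ⟨$⟩ʳ c ≡ c
        w-fixed c = by-cases c (c ≟ a)
          where
            by-cases : ∀ c → Dec (c ≡ a) → j ≤ toℕ c → w ⟨$⟩ʳ c ≡ c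
            by-cases _ (yes refl) _ = trans (cong (π ⟨$⟩ʳ_) (transposeˡ a b)) (inverseʳ π)
            by-cases c (no c≢a) j≤c = trans (cong (π ⟨$⟩ʳ_) (transpose-≢ c≢a c≢b)) πc≡c
              where
                πc≡c : π ⟨$⟩ʳ c ≡ c
                πc≡c = fixed c (≤∧≢⇒< j≤c λ j≡c →
                  c≢a (toℕ-injective (trans (sym j≡c) (sym (toℕ-fromℕ< j<m)))))
                c≢b : c ≢ b
                c≢b c≡b = c≢a (trans (sym πc≡c) (trans (cong (π ⟨$⟩ʳ_) c≡b) (inverseʳ π)))

  transpositions-generate : ∀ π → P π
  transpositions-generate π = fixing-from m π (λ a m≤a → ⊥-elim (<⇒≱ (toℕ<n a) m≤a))

^ₚ-+ : ∀ {m} (π : Permutation′ m) a b x → (π ^ₚ (a + b)) ⟨$⟩ʳ x ≡ (π ^ₚ b) ⟨$⟩ʳ ((π ^ₚ a) ⟨$⟩ʳ x)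
^ₚ-+ π zero    b x = refl
^ₚ-+ π (suc a) b x = ^ₚ-+ π a b (π ⟨$⟩ʳ x)

^ₚ-conj : ∀ {m} (σ π : Permutation′ m) j x →
          (((flip σ ∘ₚ π) ∘ₚ σ) ^ₚ j) ⟨$⟩ʳ x ≡ σ ⟨$⟩ʳ ((π ^ₚ j) ⟨$⟩ʳ (σ ⟨$⟩ˡ x))
^ₚ-conj σ π zero    x = sym (inverseʳ σ)
^ₚ-conj σ π (suc j) x =
  trans (^ₚ-conj σ π j _) (cong (λ y → σ ⟨$⟩ʳ ((π ^ₚ j) ⟨$⟩ʳ y)) (inverseˡ σ))

AllCyclesLongerThan-conj : ∀ {m k} (σ : Permutation′ m) {π : Permutation′ m} →
                           AllCyclesLongerThan k π → AllCyclesLongerThan k ((flip σ ∘ₚ π) ∘ₚ σ)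
AllCyclesLongerThan-conj σ {π} long x j 0<j j≤k returns =
  long (σ ⟨$⟩ˡ x) j 0<j j≤k
    (trans (sym (inverseˡ σ)) (cong (σ ⟨$⟩ˡ_) (trans (sym (^ₚ-conj σ π j x)) returns)))

module _ {m k : ℕ} {π : Permutation′ m} (long : AllCyclesLongerThan k π) (x : Fin m) where

  private
    orbit-distinct : ∀ {a b} → a < b → b ≤ k → (π ^ₚ a) ⟨$⟩ʳ x ≢ (π ^ₚ b) ⟨$⟩ʳ x
    orbit-distinct {a} {b} a<b b≤k eq =
      long ((π ^ₚ a) ⟨$⟩ʳ x) (b ∸ a) (m<n⇒0<n∸m a<b) (≤-trans (m∸n≤m b a) b≤k) returns
      where
        open ≡-Reasoning
        returns : (π ^ₚ (b ∸ a)) ⟨$⟩ʳ ((π ^ₚ a) ⟨$⟩ʳ x) ≡ (π ^ₚ a) ⟨$⟩ʳ x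
        returns = begin
          (π ^ₚ (b ∸ a)) ⟨$⟩ʳ ((π ^ₚ a) ⟨$⟩ʳ x) ≡⟨ sym (^ₚ-+ π a (b ∸ a) x) ⟩
          (π ^ₚ (a + (b ∸ a))) ⟨$⟩ʳ x           ≡⟨ cong (λ t → (π ^ₚ t) ⟨$⟩ʳ x) (m+[n∸m]≡n (<⇒≤ a<b)) ⟩
          (π ^ₚ b) ⟨$⟩ʳ x                       ≡⟨ sym eq ⟩
          (π ^ₚ a) ⟨$⟩ʳ x                       ∎

  orbit-injective : Injective _≡_ _≡_ (λ (j : Fin (suc k)) → (π ^ₚ toℕ j) ⟨$⟩ʳ x)
  orbit-injective {i} {j} eq with <-cmp i j
  ... | tri< i<j _ _ = ⊥-elim (orbit-distinct i<j (toℕ≤pred[n] j) eq)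
  ... | tri≈ _ i≡j _ = i≡j
  ... | tri> _ _ j<i = ⊥-elim (orbit-distinct j<i (toℕ≤pred[n] i) (sym eq))

module _ {A : Set} {m : ℕ} {f g : A → Fin m}
         (f-inj : Injective _≡_ _≡_ f) (g-inj : Injective _≡_ _≡_ g) where

  private
    ∈-remove : ∀ {h : A → Fin m} → Injective _≡_ _≡_ h → ∀ {p x y} → x ≢ y → h y ∈ p → h y ∈ p - h x
    ∈-remove h-inj x≢y hy∈p = x∈p∧x≢y⇒x∈p-y hy∈p (λ hy≡hx → x≢y (sym (h-inj hy≡hx)))

  length≤∣p∣+∣q∣ : (p q : Subset m) (xs : List A) → Unique xs →
                  All (λ x → f x ∈ p ⊎ g x ∈ q) xs → length xs ≤ ∣ p ∣ + ∣ q ∣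
  length≤∣p∣+∣q∣ p q [] _ _ = z≤n
  length≤∣p∣+∣q∣ p q (x ∷ xs) (x∉xs ∷ unique) (inj₁ fx∈p ∷ covered) = begin
    suc (length xs)           ≤⟨ s≤s (length≤∣p∣+∣q∣ (p - f x) q xs unique covered′) ⟩
    suc (∣ p - f x ∣ + ∣ q ∣) ≤⟨ +-monoˡ-≤ ∣ q ∣ (x∈p⇒∣p-x∣<∣p∣ fx∈p) ⟩
    ∣ p ∣ + ∣ q ∣             ∎
    where
      open ≤-Reasoning
      covered′ = All.zipWith (λ (x≢y , c) → map₁ (∈-remove f-inj x≢y) c) (x∉xs , covered)
  length≤∣p∣+∣q∣ p q (x ∷ xs) (x∉xs ∷ unique) (inj₂ gx∈q ∷ covered) = begin
    suc (length xs)           ≤⟨ s≤s (length≤∣p∣+∣q∣ p (q - g x) xs unique covered′) ⟩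
    suc (∣ p ∣ + ∣ q - g x ∣) ≡⟨ sym (+-suc ∣ p ∣ _) ⟩
    ∣ p ∣ + suc ∣ q - g x ∣   ≤⟨ +-monoʳ-≤ ∣ p ∣ (x∈p⇒∣p-x∣<∣p∣ gx∈q) ⟩
    ∣ p ∣ + ∣ q ∣             ∎
    where
      open ≤-Reasoning
      covered′ = All.zipWith (λ (x≢y , c) → map₂ (∈-remove g-inj x≢y) c) (x∉xs , covered)

outside-both : ∀ {N m} {f g : Fin N → Fin m} → Injective _≡_ _≡_ f → Injective _≡_ _≡_ g →
               (p q : Subset m) → ∣ p ∣ + ∣ q ∣ < N → ∃ λ x → f x ∉ p × g x ∉ q
outside-both {N} {f = f} {g} f-inj g-inj p q small
  with any? (λ x → ¬? (f x ∈? p) ×-dec ¬? (g x ∈? q))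
... | yes found = found
... | no  none  = ⊥-elim (<⇒≱ small (subst (_≤ ∣ p ∣ + ∣ q ∣) (length-tabulate (λ x → x))
                    (length≤∣p∣+∣q∣ f-inj g-inj p q (allFin N) (allFin⁺ N) (tabulate⁺ covered))))
  where
    covered : ∀ x → f x ∈ p ⊎ g x ∈ q
    covered x with f x ∈? p | g x ∈? q
    ... | yes fx∈p | _        = inj₁ fx∈p
    ... | no  _    | yes gx∈q = inj₂ gx∈q
    ... | no  fx∉p | no  gx∉q = ⊥-elim (none (x , fx∉p , gx∉q))

module _ {r : ℕ} {n : Fin r → ℕ} where

  embed : (i : Fin r) → Permutation′ (n i) → Prod n
  embed i π j with i ≟ j
  ... | yes refl = π
  ... | no  _    = id

  embed-at : ∀ i π → embed i π i ≈ₚ π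
  embed-at i π x with i ≟ i
  ... | yes refl = refl
  ... | no  i≢i  = ⊥-elim (i≢i refl)

  embed-cong : ∀ i {π ρ} → π ≈ₚ ρ → embed i π ≈ embed i ρ
  embed-cong i π≈ρ j x with i ≟ j
  ... | yes refl = π≈ρ x
  ... | no  _    = refl

  embed-id : ∀ i → e ≈ embed i id
  embed-id i j x with i ≟ j
  ... | yes refl = refl
  ... | no  _    = refl

  embed-∘ₚ : ∀ i π ρ → (embed i π · embed i ρ) ≈ embed i (π ∘ₚ ρ)
  embed-∘ₚ i π ρ j x with i ≟ j
  ... | yes refl = refl
  ... | no  _    = refl

  embed-conj : ∀ h i π → conj h (embed i π) ≈ embed i ((flip (h i) ∘ₚ π) ∘ₚ h i)
  embed-conj h i π j x with i ≟ j
  ... | yes refl = refl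
  ... | no  _    = inverseʳ (h j)

  fixes-image⇒Conjugate : ∀ σ (F : ∀ i → Subset (n i)) x →
                          (∀ i z → σ i ⟨$⟩ˡ z ∈ F i → x i ⟨$⟩ʳ z ≡ z) → Conjugate σ (FixF F) x
  fixes-image⇒Conjugate σ F x fixed = h , h-fixes , x≈conj
    where
      h = (σ · x) · inv σ
      h-fixes : FixF F h
      h-fixes i y y∈F =
        trans (cong (σ i ⟨$⟩ˡ_) (fixed i _ (subst (_∈ F i) (sym (inverseˡ (σ i))) y∈F))) (inverseˡ (σ i))
      x≈conj : x ≈ conj σ h
      x≈conj i z = sym (trans (inverseʳ (σ i)) (cong (x i ⟨$⟩ʳ_) (inverseʳ (σ i))))

  module _ {S : Prod n → Set} where

    Gen-^ₚ : ∀ {h} → Gen S h → ∀ j → Gen S (λ i → h i ^ₚ j)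
    Gen-^ₚ h∈ zero    = one
    Gen-^ₚ h∈ (suc j) = mul h∈ (Gen-^ₚ h∈ j)

    embeds-generate : (∀ i π → Gen S (embed i π)) → GeneratesAll S
    embeds-generate embed∈ x = fixing-from r x (λ i r≤i → ⊥-elim (<⇒≱ (toℕ<n i) r≤i))
      where
        fixing-from : ∀ c x → (∀ i → c ≤ toℕ i → x i ≈ₚ id) → Gen S x
        fixing-from zero x trivial = resp (λ i z → sym (trivial i z≤n z)) one
        fixing-from (suc c) x trivial with c <ℕ? r
        ... | no  c≮r = fixing-from c x (λ i c≤i → ⊥-elim (c≮r (≤-<-trans c≤i (toℕ<n i))))
        ... | yes c<r = resp x≈ (mul (fixing-from c y y-trivial) (embed∈ i₀ (x i₀)))
          where
            i₀ = fromℕ< c<r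
            y  = x · embed i₀ (flip (x i₀))
            y-trivial : ∀ i → c ≤ toℕ i → y i ≈ₚ id
            y-trivial i c≤i z with i₀ ≟ i
            ... | yes refl = inverseˡ (x i₀)
            ... | no  i₀≢i = trivial i (≤∧≢⇒< c≤i λ c≡i →
                               i₀≢i (toℕ-injective (trans (toℕ-fromℕ< c<r) c≡i))) z
            x≈ : (y · embed i₀ (x i₀)) ≈ x
            x≈ i z with i₀ ≟ i
            ... | yes refl = cong (x i₀ ⟨$⟩ʳ_) (inverseˡ (x i₀))
            ... | no  _    = refl

    embed-transpositions-generate : ∀ i → (∀ a b → Gen S (embed i (transpose a b))) →
                                    ∀ π → Gen S (embed i π)
    embed-transpositions-generate i =
      transpositions-generate (λ π → Gen S (embed i π))
        (λ {π} π≈ρ → resp {x = embed i π} (embed-cong i π≈ρ)) (resp (embed-id i) one)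
        (λ {π} {ρ} π∈ ρ∈ → resp (embed-∘ₚ i π ρ) (mul π∈ ρ∈))

    record Swappable (i : Fin r) (a b : Fin (n i)) : Set where
      constructor swappable
      field transpose∈ : Gen S (embed i (transpose a b))

    open Swappable

    module _ {i : Fin r} where

      swappable-refl : ∀ {a} → Swappable i a a
      swappable-refl {a} = swappable
        (resp {x = embed i id} (embed-cong i (λ x → sym (transpose-self a x))) (resp (embed-id i) one))

      swappable-sym : ∀ {a b} → Swappable i a b → Swappable i b a
      swappable-sym {a} {b} (swappable s) =
        swappable (resp {x = embed i (transpose a b)} (embed-cong i (transpose-comm a b)) s)

      swappable-conj : ∀ {h a b} → Gen S h → Swappable i a b → Swappable i (h i ⟨$⟩ʳ a) (h i ⟨$⟩ʳ b)
      swappable-conj {h} {a} {b} h∈ (swappable s) =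
        swappable (resp {x = embed i ((flip (h i) ∘ₚ transpose a b) ∘ₚ h i)}
                        (embed-cong i (transpose-conj (h i) a b))
                        (resp (embed-conj h i (transpose a b)) (mul (mul (invG h∈) s) h∈)))

      -- (a c) is the conjugate of (b c) by (a b).
      swappable-trans : ∀ {a b c} → Swappable i a b → Swappable i b c → Swappable i a c
      swappable-trans {a} {b} {c} sab sbc with a ≟ c | a ≟ b | b ≟ c
      ... | yes refl | _        | _        = swappable-refl
      ... | no  _    | yes refl | _        = sbc
      ... | no  _    | no  _    | yes refl = sab
      ... | no  a≢c  | no  a≢b  | no  b≢c  =
        subst₂ (Swappable i) (trans (embed-at i _ b) (transposeʳ a b))
                             (trans (embed-at i _ c)
                                    (transpose-≢ (λ c≡a → a≢c (sym c≡a)) (λ c≡b → b≢c (sym c≡b))))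
                             (swappable-conj (transpose∈ sab) sbc)

module _ {r : ℕ} {n : Fin r → ℕ} {S : Prod n → Set} (k : ℕ) (2k<n : ∀ i → 2 * k < n i)
         (F : ∀ i → Subset (n i)) (∣F∣≡k : ∀ i → ∣ F i ∣ ≡ k) (σ : Prod n)
         (stabiliser⊆ : ∀ x → (∀ i z → σ i ⟨$⟩ˡ z ∈ F i → x i ⟨$⟩ʳ z ≡ z) → Gen S x)
         (γ : Prod n) (γ∈ : Gen S γ) (γ-long : ∀ i → AllCyclesLongerThan k (γ i)) where

  private
    open Swappable

    Pinned : (i : Fin r) → Fin (n i) → Set
    Pinned i z = σ i ⟨$⟩ˡ z ∈ F i

    σ⁻¹-injective : ∀ i → Injective _≡_ _≡_ (σ i ⟨$⟩ˡ_)
    σ⁻¹-injective i eq = trans (sym (inverseʳ (σ i))) (trans (cong (σ i ⟨$⟩ʳ_) eq) (inverseʳ (σ i)))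

    swappable-unpinned : ∀ {i a b} → ¬ Pinned i a → ¬ Pinned i b → Swappable {S = S} i a b
    swappable-unpinned {i} {a} {b} a-free b-free = swappable (stabiliser⊆ _ fixes)
      where
        fixes : ∀ j z → Pinned j z → embed i (transpose a b) j ⟨$⟩ʳ z ≡ z
        fixes j z pinned with i ≟ j
        ... | yes refl = transpose-≢ {a = a} {b} {z} (λ z≡a → a-free (subst (Pinned i) z≡a pinned))
                                                   (λ z≡b → b-free (subst (Pinned i) z≡b pinned))
        ... | no  _    = refl

    orbit-leaves-pinned : ∀ i c → ∃ λ j → ¬ Pinned i ((γ i ^ₚ j) ⟨$⟩ʳ c)
    orbit-leaves-pinned i c = map toℕ proj₁ (outside-both orbit-inj orbit-inj (F i) ∅ small)
      where
        open ≤-Reasoning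
        orbit-inj : Injective _≡_ _≡_ (λ (j : Fin (suc k)) → σ i ⟨$⟩ˡ ((γ i ^ₚ toℕ j) ⟨$⟩ʳ c))
        orbit-inj eq = orbit-injective (γ-long i) c (σ⁻¹-injective i eq)
        small : ∣ F i ∣ + ∣ ∅ {n i} ∣ < suc k
        small = begin-strict
          ∣ F i ∣ + ∣ ∅ {n i} ∣ ≡⟨ cong₂ _+_ (∣F∣≡k i) (∣⊥∣≡0 (n i)) ⟩
          k + 0                 ≡⟨ +-identityʳ k ⟩
          k                     <⟨ n<1+n k ⟩
          suc k                 ∎

    unpinned-pair : ∀ i (π : Permutation′ (n i)) → ∃ λ p → ¬ Pinned i p × ¬ Pinned i (π ⟨$⟩ʳ p)
    unpinned-pair i π =
      outside-both (σ⁻¹-injective i) (λ eq → π-injective (σ⁻¹-injective i eq)) (F i) (F i) small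
      where
        open ≤-Reasoning
        π-injective : Injective _≡_ _≡_ (π ⟨$⟩ʳ_)
        π-injective eq = trans (sym (inverseˡ π)) (trans (cong (π ⟨$⟩ˡ_) eq) (inverseˡ π))
        small : ∣ F i ∣ + ∣ F i ∣ < n i
        small = begin-strict
          ∣ F i ∣ + ∣ F i ∣ ≡⟨ cong₂ _+_ (∣F∣≡k i) (∣F∣≡k i) ⟩
          k + k             ≡⟨ cong (k +_) (sym (+-identityʳ k)) ⟩
          2 * k             <⟨ 2k<n i ⟩
          n i               ∎

    swappable-with-unpinned : ∀ i c → ∃ λ p → ¬ Pinned i p × Swappable i c p
    swappable-with-unpinned i c with orbit-leaves-pinned i c
    ... | j , γʲc-free with unpinned-pair i (γ i ^ₚ j)
    ...   | p , p-free , γʲp-free =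
      p , p-free ,
      subst₂ (Swappable i) (inverseˡ (γ i ^ₚ j)) (inverseˡ (γ i ^ₚ j))
        (swappable-conj (invG (Gen-^ₚ γ∈ j)) (swappable-unpinned γʲc-free γʲp-free))

    all-swappable : ∀ i a b → Swappable i a b
    all-swappable i a b =
      let p , p-free , a~p = swappable-with-unpinned i a
          q , q-free , b~q = swappable-with-unpinned i b
      in swappable-trans a~p (swappable-trans (swappable-unpinned p-free q-free) (swappable-sym b~q))

  generated-by-stabiliser-and-long-cycle : GeneratesAll S
  generated-by-stabiliser-and-long-cycle =
    embeds-generate (λ i → embed-transpositions-generate i (λ a b → transpose∈ (all-swappable i a b)))

mainTheorem9 : (r : ℕ) (n : Fin r → ℕ) (k : ℕ) → 0 < k → (∀ i → 2 * k < n i)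
    → (F : (i : Fin r) → Subset (n i)) → (∀ i → ∣ F i ∣ ≡ k)
    → (g : Prod n) → (∀ i → AllCyclesLongerThan k (g i))
    → InvariablyGenerate (FixF F) (Cyclic g)
mainTheorem9 r n k _ 2k<n F ∣F∣≡k g g-long σ₁ σ₂ =
  generated-by-stabiliser-and-long-cycle k 2k<n F ∣F∣≡k σ₁
    (λ x fixes → gen (inj₁ (fixes-image⇒Conjugate σ₁ F x fixes)))
    (conj σ₂ g) (gen (inj₂ (g , gen (λ _ _ → refl) , λ _ _ → refl)))
    (λ i → AllCyclesLongerThan-conj (σ₂ i) (g-long i))
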